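{- Let $G=3.\mathrm A_6$ be the non-split central extension of $\mathbb Z_3$ by $\mathrm A_6$. Then $G$ has rotary pairs $(a,z)$ and $(a',z)$, for each of which $\mathrm{BiRoMap}$ is defined, such that (a) $(\langle a\rangle,\langle z\rangle,\langle z,z^a\rangle)=(\langle a'\rangle,\langle z\rangle,\langle z,z^{a'}\rangle)$, and (b) $\mathrm{BiRoMap}(G,a,z)\neq\mathrm{BiRoMap}(G,a',z)$.
   Context: A rotary pair for $G$ is $(a,z)$ with $G=\langle a,z\rangle$, $|a|$ finite, $|z|=2$, $z\notin\langle a\rangle$; $x^g=g^{ -1}xg$. For a rotary pair with $|a|\ge3$, $\langle a\rangle\ne\langle a\rangle^z$ and $\ell=|zz^a|$ finite, $\mathrm{BiRoMap}(G,a,z)$ is the map whose underlying graph has vertex set $[G:\langle a\rangle]$, edge set $[G:\langle z\rangle]$ (right cosets), vertex–edge incidence by non-empty intersection, and whose faces are the edge sequences $C(W)g$, $g\in G$, where $C(W)=(e'_0,\dots,e'_{2\ell-1})$, $e'_{2i}=\langle z\rangle(zz^a)^i$, $e'_{2i+1}=\langle z\rangle a(zz^a)^i$ (faces regarded up to cyclic shift and reversal), glued as discs along common edges. Two such maps on the same underlying graph are different if their sets of face boundary cycles differ. -}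

module Defs where

-- Concrete model of G = 3.A6 : the preimage in SL(3,4) of the stabiliser in
-- PSL(3,4) of the hyperoval {<(1,t,t^2)> : t ∈ GF(4)} ∪ {<(0,0,1)>, <(0,1,0)>},
-- acting faithfully (on the right, row vectors) on the 18 non-zero vectors
-- lying on the hyperoval points.  The two permutations g₁, g₂ below generate
-- this group of order 1080 (centre of order 3, quotient A6, non-split).

open import Data.Nat using (ℕ; zero; suc; _+_; _*_; _∸_; _<_; _≤_; _%_; _/_)
open import Data.Fin using (Fin; #_) renaming (zero to fzero; suc to fsuc; _≟_ to _≟F_)
open import Data.Vec using (Vec; []; _∷_; lookup; tabulate; map; allFin)
open import Data.List using (List) renaming ([] to []ᴸ; _∷_ to _∷ᴸ_)
open import Data.List.Membership.Propositional using (_∈_)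
open import Data.Maybe using (Maybe; just; nothing; fromMaybe) renaming (map to mapᴹ)
open import Data.Product using (Σ; ∃; _×_; _,_)
open import Data.Sum using (_⊎_)
open import Relation.Binary.PropositionalEquality using (_≡_; _≢_)
open import Relation.Nullary using (¬_; yes; no)
open import Function.Bundles using (_⇔_)

-- permutations of {0,…,17}, p given by its list of images p(0),…,p(17)
Perm : Set
Perm = Vec (Fin 18) 18

idP : Perm
idP = allFin 18

-- product: apply p first, then q  (right actions, x^g = g⁻¹ x g)
infixl 7 _·_
_·_ : Perm → Perm → Perm
p · q = map (lookup q) p

findIdx : ∀ {n} → Fin 18 → Vec (Fin 18) n → Maybe (Fin n)
findIdx x [] = nothing
findIdx x (y ∷ ys) with x ≟F y
... | yes _ = just fzero
... | no _ = mapᴹ fsuc (findIdx x ys)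

-- inverse permutation (correct on genuine permutations)
inv : Perm → Perm
inv p = tabulate (λ i → fromMaybe fzero (findIdx i p))

pow : Perm → ℕ → Perm
pow p zero = idP
pow p (suc k) = pow p k · p

conj : Perm → Perm → Perm
conj x g = inv g · x · g

data ⟨_⟩ (S : List Perm) : Perm → Set where
  one    : ⟨ S ⟩ idP
  mulR   : ∀ {x s} → ⟨ S ⟩ x → s ∈ S → ⟨ S ⟩ (x · s)
  mulInv : ∀ {x s} → ⟨ S ⟩ x → s ∈ S → ⟨ S ⟩ (x · inv s)

Subset : Set₁
Subset = Perm → Set

SameSet : Subset → Subset → Set
SameSet A B = ∀ x → A x ⇔ B x

conjSet : Subset → Perm → Subset
conjSet H g x = ∃ λ h → H h × x ≡ conj h g

coset : Subset → Perm → Subset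
coset H h x = ∃ λ y → H y × x ≡ y · h

g₁ : Perm
g₁ = # 17 ∷ # 7 ∷ # 12 ∷ # 11 ∷ # 16 ∷ # 9 ∷ # 4 ∷ # 6 ∷ # 8 ∷ # 2 ∷ # 5 ∷ # 0 ∷ # 10 ∷ # 13 ∷ # 3 ∷ # 15 ∷ # 1 ∷ # 14 ∷ []

g₂ : Perm
g₂ = # 15 ∷ # 8 ∷ # 13 ∷ # 5 ∷ # 3 ∷ # 4 ∷ # 2 ∷ # 16 ∷ # 12 ∷ # 6 ∷ # 0 ∷ # 10 ∷ # 9 ∷ # 17 ∷ # 1 ∷ # 7 ∷ # 14 ∷ # 11 ∷ []

G : Subset
G = ⟨ g₁ ∷ᴸ g₂ ∷ᴸ []ᴸ ⟩

IsOrder : Perm → ℕ → Set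
IsOrder p k = 0 < k × pow p k ≡ idP × (∀ j → 0 < j → j < k → pow p j ≢ idP)

RotaryPair : Perm → Perm → Set
RotaryPair a z =
  G a × G z × SameSet G ⟨ a ∷ᴸ z ∷ᴸ []ᴸ ⟩ × IsOrder z 2 × ¬ ⟨ a ∷ᴸ []ᴸ ⟩ z

BiRoDefined : Perm → Perm → ℕ → Set
BiRoDefined a z ℓ =
  (∃ λ n → IsOrder a n × 3 ≤ n)
  × ¬ SameSet ⟨ a ∷ᴸ []ᴸ ⟩ (conjSet ⟨ a ∷ᴸ []ᴸ ⟩ z)
  × IsOrder (z · conj z a) ℓ

-- edges are right cosets of ⟨z⟩ (as subsets of G); equality of cosets as sets
Edge : Set₁
Edge = Subset

EdgeEq : Edge → Edge → Set
EdgeEq = SameSet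

-- a face boundary: its length L and its edges e_0,…,e_{L-1} (indices < L used)
Face : Set₁
Face = Σ ℕ (λ _ → ℕ → Edge)

modL : ℕ → ℕ → ℕ
modL zero n = n
modL (suc k) n = n % suc k

CycEq : Face → Face → Set
CycEq (L , f) (L' , f') =
  L ≡ L' × ∃ λ s → s < L ×
    ((∀ j → j < L → EdgeEq (f j) (f' (modL L (s + j))))
     ⊎ (∀ j → j < L → EdgeEq (f j) (f' (modL L (s + (L ∸ j))))))

-- representative of e'_j g in C(W)g, with w = z z^a:
-- e'_{2i} g = ⟨z⟩ w^i g ,  e'_{2i+1} g = ⟨z⟩ a w^i g
faceRep : Perm → Perm → Perm → ℕ → Perm
faceRep a w g j with j % 2
... | zero = pow w (j / 2) · g
... | suc _ = a · pow w (j / 2) · g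

biRoFace : Perm → Perm → ℕ → Perm → Face
biRoFace a z ℓ g = (2 * ℓ , λ j → coset ⟨ z ∷ᴸ []ᴸ ⟩ (faceRep a (z · conj z a) g j))

SameFaces : (Perm → Face) → (Perm → Face) → Set
SameFaces F F' =
  (∀ g → G g → ∃ λ h → G h × CycEq (F g) (F' h))
  × (∀ h → G h → ∃ λ g → G g × CycEq (F' h) (F g))

{-# OPTIONS --safe #-}
-- ρ has order 12 and ρ⁴ generates the centre of 3.A₆, so ρ⁵ = ρ·ρ⁴ generates the same cyclic
-- group as ρ and induces the same conjugate ζ^ρ⁵ = ζ^ρ: the two pairs share all the data in (a),
-- and ℓ = 4 for both.  The maps still differ: the face C(W) of BiRoMap(G,ρ,ζ) has consecutive
-- edges ⟨ζ⟩ and ⟨ζ⟩ρ.  Were it a face C(W′)h of BiRoMap(G,ρ⁵,ζ), the position of ⟨ζ⟩ in C(W′)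
-- (one of 8, read in one of 2 directions) would determine h up to the two elements of ⟨ζ⟩, and
-- in each of these 32 cases the next edge is not ⟨ζ⟩ρ.
module Submission where

open import Defs
open import Data.Nat using (ℕ; zero; suc; _+_; _*_; _∸_; _%_; _<_; z≤n; s≤s; _<?_)
open import Data.Nat.Properties using (<-trans; allUpTo?)
open import Data.Fin using (#_) renaming (_≟_ to _≟ᶠ_)
open import Data.Vec using ([]; _∷_; lookup)
open import Data.Vec.Properties using (≡-dec; map-lookup-allFin; lookup-allFin; lookup-map; map-∘; map-cong; map-id)
open import Data.List using (List; []; _∷_; upTo) renaming (map to mapᴸ)
open import Data.List.Membership.Propositional using (_∈_; _∉_)
open import Data.List.Relation.Unary.All using (All; []; _∷_; all?) renaming (lookup to lookupᴬ)
open import Data.List.Relation.Unary.Any using (here; there)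
open import Data.Product using (∃; _×_; _,_; proj₁; proj₂)
open import Data.Empty using (⊥)
open import Data.Sum using (_⊎_; inj₁; inj₂) renaming (map to mapˢ)
open import Function.Bundles using (Equivalence; mk⇔)
open import Function.Properties.Equivalence using () renaming (refl to ⇔-refl; trans to ⇔-trans)
open import Relation.Binary.PropositionalEquality using (_≡_; _≢_; refl; sym; trans; cong; subst; module ≡-Reasoning)
open import Relation.Nullary using (¬_; Dec; ¬?)
open import Relation.Nullary.Decidable using (from-yes; map′; _×-dec_; _→-dec_)

open Equivalence using (to; from)

infix 4 _≟ᴾ_
_≟ᴾ_ : (p q : Perm) → Dec (p ≡ q)
_≟ᴾ_ = ≡-dec _≟ᶠ_

open import Data.List.Membership.DecPropositional _≟ᴾ_ using (_∈?_; _∉?_)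

·-identityˡ : ∀ p → idP · p ≡ p
·-identityˡ = map-lookup-allFin

·-identityʳ : ∀ p → p · idP ≡ p
·-identityʳ p = trans (map-cong lookup-allFin p) (map-id p)

·-assoc : ∀ p q r → (p · q) · r ≡ p · (q · r)
·-assoc p q r =
  trans (sym (map-∘ (lookup r) (lookup q) p)) (map-cong (λ i → sym (lookup-map i (lookup r) q)) p)

cancelˡ : ∀ {q x r} h → q · x ≡ idP → r ≡ x · h → h ≡ q · r
cancelˡ {q} {x} {r} h qx≡id r≡xh = begin
  h             ≡⟨ sym (·-identityˡ h) ⟩
  idP · h       ≡⟨ cong (_· h) (sym qx≡id) ⟩
  (q · x) · h   ≡⟨ ·-assoc q x h ⟩
  q · (x · h)   ≡⟨ cong (q ·_) (sym r≡xh) ⟩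
  q · r         ∎
  where open ≡-Reasoning

module _ {S : List Perm} where

  ⟨⟩-gen : ∀ {s} → s ∈ S → ⟨ S ⟩ s
  ⟨⟩-gen {s} s∈S = subst ⟨ S ⟩ (·-identityˡ s) (mulR one s∈S)

  ⟨⟩-gen⁻¹ : ∀ {s} → s ∈ S → ⟨ S ⟩ (inv s)
  ⟨⟩-gen⁻¹ {s} s∈S = subst ⟨ S ⟩ (·-identityˡ (inv s)) (mulInv one s∈S)

  ⟨⟩-· : ∀ {x y} → ⟨ S ⟩ x → ⟨ S ⟩ y → ⟨ S ⟩ (x · y)
  ⟨⟩-· {x} hx one = subst ⟨ S ⟩ (sym (·-identityʳ x)) hx
  ⟨⟩-· {x} hx (mulR {y} {s} hy s∈S) = subst ⟨ S ⟩ (·-assoc x y s) (mulR (⟨⟩-· hx hy) s∈S)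
  ⟨⟩-· {x} hx (mulInv {y} {s} hy s∈S) = subst ⟨ S ⟩ (·-assoc x y (inv s)) (mulInv (⟨⟩-· hx hy) s∈S)

  ⟨⟩-pow : ∀ {x} → ⟨ S ⟩ x → ∀ k → ⟨ S ⟩ (pow x k)
  ⟨⟩-pow hx zero = one
  ⟨⟩-pow hx (suc k) = ⟨⟩-· (⟨⟩-pow hx k) hx

  ⟨⟩-inv : ∀ {x} k → inv x ≡ pow x k → ⟨ S ⟩ x → ⟨ S ⟩ (inv x)
  ⟨⟩-inv k inv≡pow hx = subst ⟨ S ⟩ (sym inv≡pow) (⟨⟩-pow hx k)

⟨⟩-⊆ : ∀ {S U} → All (λ s → ⟨ U ⟩ s × ⟨ U ⟩ (inv s)) S → ∀ {x} → ⟨ S ⟩ x → ⟨ U ⟩ x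
⟨⟩-⊆ gens one = one
⟨⟩-⊆ gens (mulR hx s∈S) = ⟨⟩-· (⟨⟩-⊆ gens hx) (proj₁ (lookupᴬ gens s∈S))
⟨⟩-⊆ gens (mulInv hx s∈S) = ⟨⟩-· (⟨⟩-⊆ gens hx) (proj₂ (lookupᴬ gens s∈S))

sameSet-refl : ∀ {A} → SameSet A A
sameSet-refl _ = ⇔-refl

⟨⟩-sameSet : ∀ {S U} → All (λ s → ⟨ U ⟩ s × ⟨ U ⟩ (inv s)) S → All (λ u → ⟨ S ⟩ u × ⟨ S ⟩ (inv u)) U →
             SameSet ⟨ S ⟩ ⟨ U ⟩
⟨⟩-sameSet S⊆U U⊆S x = mk⇔ (⟨⟩-⊆ S⊆U) (⟨⟩-⊆ U⊆S)

data Word (U : List Perm) : Set where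
  ε   : Word U
  _▸_ : ∀ {s} → s ∈ U → Word U → Word U
  _◂_ : ∀ {s} → s ∈ U → Word U → Word U
infixr 5 _▸_ _◂_

pattern #₀ = here refl
pattern #₁ = there (here refl)

evalFrom : ∀ {U} → Perm → Word U → Perm
evalFrom x ε = x
evalFrom x (_▸_ {s} _ w) = evalFrom (x · s) w
evalFrom x (_◂_ {s} _ w) = evalFrom (x · inv s) w

⟨⟩-evalFrom : ∀ {U x} → ⟨ U ⟩ x → (w : Word U) → ⟨ U ⟩ (evalFrom x w)
⟨⟩-evalFrom hx ε = hx
⟨⟩-evalFrom hx (s∈U ▸ w) = ⟨⟩-evalFrom (mulR hx s∈U) w
⟨⟩-evalFrom hx (s∈U ◂ w) = ⟨⟩-evalFrom (mulInv hx s∈U) w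

⟨⟩-word : ∀ {U x} (w : Word U) → evalFrom idP w ≡ x → ⟨ U ⟩ x
⟨⟩-word w refl = ⟨⟩-evalFrom one w

Closed : List Perm → List Perm → Set
Closed S L = All (λ x → All (λ s → x · s ∈ L × x · inv s ∈ L) S) L

closed? : ∀ S L → Dec (Closed S L)
closed? S L = all? (λ x → all? (λ s → (x · s ∈? L) ×-dec (x · inv s ∈? L)) S) L

⟨⟩⊆closed : ∀ {S L} → idP ∈ L → Closed S L → ∀ {x} → ⟨ S ⟩ x → x ∈ L
⟨⟩⊆closed id∈L cl one = id∈L
⟨⟩⊆closed id∈L cl (mulR hx s∈S) = proj₁ (lookupᴬ (lookupᴬ cl (⟨⟩⊆closed id∈L cl hx)) s∈S)
⟨⟩⊆closed id∈L cl (mulInv hx s∈S) = proj₂ (lookupᴬ (lookupᴬ cl (⟨⟩⊆closed id∈L cl hx)) s∈S)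

powers : Perm → ℕ → List Perm
powers x n = mapᴸ (pow x) (upTo n)

isOrder? : ∀ p k → Dec (IsOrder p k)
isOrder? p k = (0 <? k) ×-dec (pow p k ≟ᴾ idP) ×-dec
  map′ (λ f j 0<j j<k → f j<k 0<j) (λ f {j} j<k 0<j → f j 0<j j<k)
       (allUpTo? (λ j → (0 <? j) →-dec ¬? (pow p j ≟ᴾ idP)) k)

⟨⟩≢conjSet : ∀ {a z L} → (∀ {x} → ⟨ a ∷ [] ⟩ x → x ∈ L) → conj a z ∉ L →
             ¬ SameSet ⟨ a ∷ [] ⟩ (conjSet ⟨ a ∷ [] ⟩ z)
⟨⟩≢conjSet ⟨a⟩⊆L a^z∉L same = a^z∉L (⟨a⟩⊆L (from (same _) (_ , ⟨⟩-gen #₀ , refl)))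

⟨⟩-⊆-pair : ∀ {x y g} → ⟨ x ∷ [] ⟩ g → ⟨ x ∷ y ∷ [] ⟩ g
⟨⟩-⊆-pair = ⟨⟩-⊆ ((⟨⟩-gen #₀ , ⟨⟩-gen⁻¹ #₀) ∷ [])

rotaryPair-cong : ∀ {a b z} → SameSet ⟨ a ∷ [] ⟩ ⟨ b ∷ [] ⟩ → RotaryPair a z → RotaryPair b z
rotaryPair-cong {a} {b} {z} ⟨a⟩≡⟨b⟩ (_ , Gz , G≡⟨a,z⟩ , |z|≡2 , z∉⟨a⟩) =
  from (G≡⟨b,z⟩ b) (⟨⟩-⊆-pair (⟨⟩-gen #₀)) , Gz , G≡⟨b,z⟩ , |z|≡2 ,
  λ z∈⟨b⟩ → z∉⟨a⟩ (from (⟨a⟩≡⟨b⟩ z) z∈⟨b⟩)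
  where
  ⟨a⟩⊆⟨b,z⟩ : ∀ {x} → ⟨ a ∷ [] ⟩ x → ⟨ b ∷ z ∷ [] ⟩ x
  ⟨a⟩⊆⟨b,z⟩ hx = ⟨⟩-⊆-pair (to (⟨a⟩≡⟨b⟩ _) hx)
  ⟨b⟩⊆⟨a,z⟩ : ∀ {x} → ⟨ b ∷ [] ⟩ x → ⟨ a ∷ z ∷ [] ⟩ x
  ⟨b⟩⊆⟨a,z⟩ hx = ⟨⟩-⊆-pair (from (⟨a⟩≡⟨b⟩ _) hx)
  G≡⟨b,z⟩ : SameSet G ⟨ b ∷ z ∷ [] ⟩
  G≡⟨b,z⟩ x = ⇔-trans (G≡⟨a,z⟩ x) (⟨⟩-sameSet
    ((⟨a⟩⊆⟨b,z⟩ (⟨⟩-gen #₀) , ⟨a⟩⊆⟨b,z⟩ (⟨⟩-gen⁻¹ #₀)) ∷ (⟨⟩-gen #₁ , ⟨⟩-gen⁻¹ #₁) ∷ [])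
    ((⟨b⟩⊆⟨a,z⟩ (⟨⟩-gen #₀) , ⟨b⟩⊆⟨a,z⟩ (⟨⟩-gen⁻¹ #₀)) ∷ (⟨⟩-gen #₁ , ⟨⟩-gen⁻¹ #₁) ∷ []) x)

translation-determined : ∀ {q u p u′ p′ h r₀ r₁} → q · (u · p) ≡ idP →
  r₀ ≡ u · (p · h) → r₁ ≡ u′ · (p′ · h) → r₁ ≡ u′ · (p′ · (q · r₀))
translation-determined {q} {u} {p} {u′} {p′} {h} {r₀} {r₁} inverse r₀≡ r₁≡ = begin
  r₁                   ≡⟨ r₁≡ ⟩
  u′ · (p′ · h)        ≡⟨ cong (λ g → u′ · (p′ · g)) (cancelˡ h inverse (trans r₀≡ (sym (·-assoc u p h)))) ⟩
  u′ · (p′ · (q · r₀)) ∎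
  where open ≡-Reasoning

sameCoset⇒ : ∀ {H} x y → H idP → EdgeEq (coset H x) (coset H y) → ∃ λ u → H u × x ≡ u · y
sameCoset⇒ x y H∋id same = to (same x) (idP , H∋id , sym (·-identityˡ x))

faceRep-· : ∀ a w g j → faceRep a w g j ≡ faceRep a w idP j · g
faceRep-· a w g j with j % 2
... | zero  = cong (_· g) (sym (·-identityʳ _))
... | suc _ = cong (_· g) (sym (·-identityʳ _))

module FirstEdges (a a′ z : Perm) (ℓ : ℕ) where

  w w′ : Perm
  w  = z · conj z a
  w′ = z · conj z a′

  R R′ : ℕ → Perm
  R  = faceRep a  w  idP
  R′ = faceRep a′ w′ idP

  Z : Subset
  Z = ⟨ z ∷ [] ⟩

  Matches : ℕ → ℕ → Perm → Set
  Matches k k′ h = EdgeEq (coset Z (R 0)) (coset Z (faceRep a′ w′ h k))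
                 × EdgeEq (coset Z (R 1)) (coset Z (faceRep a′ w′ h k′))

  rotation reflection : ℕ → ℕ → ℕ
  rotation   s j = modL (2 * ℓ) (s + j)
  reflection s j = modL (2 * ℓ) (s + (2 * ℓ ∸ j))

  cycEq⇒matches : 1 < 2 * ℓ → ∀ {h} → CycEq (biRoFace a z ℓ idP) (biRoFace a′ z ℓ h) →
                  ∃ λ s → s < 2 * ℓ × (Matches (rotation s 0) (rotation s 1) h ⊎ Matches (reflection s 0) (reflection s 1) h)
  cycEq⇒matches 1<2ℓ (_ , s , s<2ℓ , orientation) =
    s , s<2ℓ , mapˢ (λ H → H 0 0<2ℓ , H 1 1<2ℓ) (λ H → H 0 0<2ℓ , H 1 1<2ℓ) orientation
    where
    0<2ℓ : 0 < 2 * ℓ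
    0<2ℓ = <-trans (s≤s z≤n) 1<2ℓ

  -- With ⟨z⟩ ⊆ Zs, matching the first edge at position k forces h = (u · R′ k)⁻¹ · R 0 for some
  -- u ∈ Zs; NoMatch says that for every such h the second edge then fails to match.
  NoMatch : List Perm → ℕ → ℕ → Set
  NoMatch Zs k k′ = All (λ u → let q = inv (u · R′ k) in
    q · (u · R′ k) ≡ idP × All (λ u′ → R 1 ≢ u′ · (R′ k′ · (q · R 0))) Zs) Zs

  noMatch? : ∀ Zs k k′ → Dec (NoMatch Zs k k′)
  noMatch? Zs k k′ = all? (λ u → let q = inv (u · R′ k) in
    (q · (u · R′ k) ≟ᴾ idP) ×-dec all? (λ u′ → ¬? (R 1 ≟ᴾ u′ · (R′ k′ · (q · R 0)))) Zs) Zs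

  noMatch⇒¬matches : ∀ {Zs} k k′ h → (∀ {x} → Z x → x ∈ Zs) → NoMatch Zs k k′ → ¬ Matches k k′ h
  noMatch⇒¬matches {Zs} k k′ h Z⊆Zs noMatch (e₀ , e₁) =
    refute (sameCoset⇒ (R 0) (faceRep a′ w′ h k) one e₀) (sameCoset⇒ (R 1) (faceRep a′ w′ h k′) one e₁)
    where
    refute : (∃ λ u → Z u × R 0 ≡ u · faceRep a′ w′ h k) → (∃ λ u′ → Z u′ × R 1 ≡ u′ · faceRep a′ w′ h k′) → ⊥
    refute (u , Zu , R₀≡) (u′ , Zu′ , R₁≡) =
      lookupᴬ (proj₂ (lookupᴬ noMatch (Z⊆Zs Zu))) (Z⊆Zs Zu′)
        (translation-determined {p = R′ k} {p′ = R′ k′} {h = h} (proj₁ (lookupᴬ noMatch (Z⊆Zs Zu)))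
          (trans R₀≡ (cong (u ·_) (faceRep-· a′ w′ h k)))
          (trans R₁≡ (cong (u′ ·_) (faceRep-· a′ w′ h k′))))

  ¬sameFaces : ∀ {Zs} → 1 < 2 * ℓ → (∀ {x} → Z x → x ∈ Zs) →
    (∀ {s} → s < 2 * ℓ → NoMatch Zs (rotation s 0) (rotation s 1) × NoMatch Zs (reflection s 0) (reflection s 1)) →
    ¬ SameFaces (biRoFace a z ℓ) (biRoFace a′ z ℓ)
  ¬sameFaces 1<2ℓ Z⊆Zs noMatch (a-faces⊆a′-faces , _) = refute (a-faces⊆a′-faces idP one)
    where
    refute : ∃ (λ h → G h × CycEq (biRoFace a z ℓ idP) (biRoFace a′ z ℓ h)) → ⊥
    refute (h , _ , cyc) with cycEq⇒matches 1<2ℓ cyc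
    ... | s , s<2ℓ , inj₁ m = noMatch⇒¬matches (rotation s 0) (rotation s 1) h Z⊆Zs (proj₁ (noMatch s<2ℓ)) m
    ... | s , s<2ℓ , inj₂ m = noMatch⇒¬matches (reflection s 0) (reflection s 1) h Z⊆Zs (proj₂ (noMatch s<2ℓ)) m

ρ ζ : Perm
ρ = # 3 ∷ # 4 ∷ # 5 ∷ # 2 ∷ # 0 ∷ # 1 ∷ # 11 ∷ # 10 ∷ # 12 ∷ # 13 ∷ # 16 ∷ # 15 ∷ # 14 ∷ # 17 ∷ # 9 ∷ # 7 ∷ # 8 ∷ # 6 ∷ []
ζ = # 0 ∷ # 1 ∷ # 2 ∷ # 10 ∷ # 14 ∷ # 6 ∷ # 5 ∷ # 13 ∷ # 17 ∷ # 9 ∷ # 3 ∷ # 11 ∷ # 15 ∷ # 7 ∷ # 4 ∷ # 12 ∷ # 16 ∷ # 8 ∷ []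

ρ⁵ : Perm
ρ⁵ = pow ρ 5

ρ²⁵≡ρ : pow ρ⁵ 5 ≡ ρ
ρ²⁵≡ρ = refl

ρ∈G : G ρ
ρ∈G = ⟨⟩-word (#₀ ◂ #₁ ◂ #₁ ◂ #₀ ◂ #₁ ▸ #₁ ▸ #₀ ◂ ε) refl

ζ∈G : G ζ
ζ∈G = ⟨⟩-word (#₀ ▸ #₀ ▸ #₁ ▸ #₀ ▸ #₁ ◂ #₁ ◂ ε) refl

g₁∈⟨ρ,ζ⟩ : ⟨ ρ ∷ ζ ∷ [] ⟩ g₁
g₁∈⟨ρ,ζ⟩ = ⟨⟩-word (#₀ ▸ #₁ ▸ #₀ ▸ #₁ ▸ #₀ ▸ #₁ ▸ ε) refl

g₂∈⟨ρ,ζ⟩ : ⟨ ρ ∷ ζ ∷ [] ⟩ g₂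
g₂∈⟨ρ,ζ⟩ = ⟨⟩-word (#₀ ◂ #₁ ▸ #₀ ▸ #₁ ▸ #₀ ▸ #₀ ▸ #₁ ▸ #₀ ▸ #₁ ▸ ε) refl

G≡⟨ρ,ζ⟩ : SameSet G ⟨ ρ ∷ ζ ∷ [] ⟩
G≡⟨ρ,ζ⟩ = ⟨⟩-sameSet
  ((g₁∈⟨ρ,ζ⟩ , ⟨⟩-inv 4 refl g₁∈⟨ρ,ζ⟩) ∷ (g₂∈⟨ρ,ζ⟩ , ⟨⟩-inv 14 refl g₂∈⟨ρ,ζ⟩) ∷ [])
  ((ρ∈G , ⟨⟩-inv 11 refl ρ∈G) ∷ (ζ∈G , ⟨⟩-inv 1 refl ζ∈G) ∷ [])

⟨ρ⟩⊆powers : ∀ {x} → ⟨ ρ ∷ [] ⟩ x → x ∈ powers ρ 12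
⟨ρ⟩⊆powers = ⟨⟩⊆closed #₀ (from-yes (closed? (ρ ∷ []) (powers ρ 12)))

⟨ζ⟩⊆powers : ∀ {x} → ⟨ ζ ∷ [] ⟩ x → x ∈ powers ζ 2
⟨ζ⟩⊆powers = ⟨⟩⊆closed #₀ (from-yes (closed? (ζ ∷ []) (powers ζ 2)))

⟨ρ⟩≡⟨ρ⁵⟩ : SameSet ⟨ ρ ∷ [] ⟩ ⟨ ρ⁵ ∷ [] ⟩
⟨ρ⟩≡⟨ρ⁵⟩ = ⟨⟩-sameSet ((ρ∈⟨ρ⁵⟩ , ⟨⟩-inv 11 refl ρ∈⟨ρ⁵⟩) ∷ []) ((ρ⁵∈⟨ρ⟩ , ⟨⟩-inv 11 refl ρ⁵∈⟨ρ⟩) ∷ [])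
  where
  ρ⁵∈⟨ρ⟩ : ⟨ ρ ∷ [] ⟩ ρ⁵
  ρ⁵∈⟨ρ⟩ = ⟨⟩-pow (⟨⟩-gen #₀) 5
  ρ∈⟨ρ⁵⟩ : ⟨ ρ⁵ ∷ [] ⟩ ρ
  ρ∈⟨ρ⁵⟩ = subst ⟨ ρ⁵ ∷ [] ⟩ ρ²⁵≡ρ (⟨⟩-pow (⟨⟩-gen #₀) 5)

rotaryPair-ρ : RotaryPair ρ ζ
rotaryPair-ρ = ρ∈G , ζ∈G , G≡⟨ρ,ζ⟩ , from-yes (isOrder? ζ 2) ,
  λ ζ∈⟨ρ⟩ → from-yes (ζ ∉? powers ρ 12) (⟨ρ⟩⊆powers ζ∈⟨ρ⟩)

biRoDefined-ρ : BiRoDefined ρ ζ 4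
biRoDefined-ρ = (12 , from-yes (isOrder? ρ 12) , s≤s (s≤s (s≤s z≤n))) ,
  ⟨⟩≢conjSet {z = ζ} ⟨ρ⟩⊆powers (from-yes (conj ρ ζ ∉? powers ρ 12)) , from-yes (isOrder? (ζ · conj ζ ρ) 4)

biRoDefined-ρ⁵ : BiRoDefined ρ⁵ ζ 4
biRoDefined-ρ⁵ = (12 , from-yes (isOrder? ρ⁵ 12) , s≤s (s≤s (s≤s z≤n))) ,
  ⟨⟩≢conjSet {z = ζ} (λ x∈⟨ρ⁵⟩ → ⟨ρ⟩⊆powers (from (⟨ρ⟩≡⟨ρ⁵⟩ _) x∈⟨ρ⁵⟩)) (from-yes (conj ρ⁵ ζ ∉? powers ρ 12)) ,
  from-yes (isOrder? (ζ · conj ζ ρ⁵) 4)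

-- ρ⁴ is central.
ζ^ρ≡ζ^ρ⁵ : conj ζ ρ ≡ conj ζ ρ⁵
ζ^ρ≡ζ^ρ⁵ = refl

¬sameFaces-ρ-ρ⁵ : ¬ SameFaces (biRoFace ρ ζ 4) (biRoFace ρ⁵ ζ 4)
¬sameFaces-ρ-ρ⁵ = FirstEdges.¬sameFaces ρ ρ⁵ ζ 4 (s≤s (s≤s z≤n)) ⟨ζ⟩⊆powers
  (from-yes (allUpTo? (λ s → noMatch? (powers ζ 2) (rotation s 0) (rotation s 1)
                       ×-dec noMatch? (powers ζ 2) (reflection s 0) (reflection s 1)) 8))
  where open FirstEdges ρ ρ⁵ ζ 4

proposition4p6 :
    ∃ λ (a : Perm) → ∃ λ (a' : Perm) → ∃ λ (z : Perm) → ∃ λ (ℓ : ℕ) → ∃ λ (ℓ' : ℕ) →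
      RotaryPair a z × RotaryPair a' z
      × BiRoDefined a z ℓ × BiRoDefined a' z ℓ'
      × (SameSet ⟨ a ∷ [] ⟩ ⟨ a' ∷ [] ⟩
         × SameSet ⟨ z ∷ [] ⟩ ⟨ z ∷ [] ⟩
         × SameSet ⟨ z ∷ conj z a ∷ [] ⟩ ⟨ z ∷ conj z a' ∷ [] ⟩)
      × ¬ SameFaces (biRoFace a z ℓ) (biRoFace a' z ℓ')
proposition4p6 =
  ρ , ρ⁵ , ζ , 4 , 4 ,
  rotaryPair-ρ , rotaryPair-cong ⟨ρ⟩≡⟨ρ⁵⟩ rotaryPair-ρ ,
  biRoDefined-ρ , biRoDefined-ρ⁵ ,
  (⟨ρ⟩≡⟨ρ⁵⟩ , sameSet-refl , subst (λ c → SameSet ⟨ ζ ∷ conj ζ ρ ∷ [] ⟩ ⟨ ζ ∷ c ∷ [] ⟩) ζ^ρ≡ζ^ρ⁵ sameSet-refl) ,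
  ¬sameFaces-ρ-ρ⁵
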